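{- Let $\mathbb{F}$ be a field, let $n$ be a positive integer, let $G$ be a finite simple graph, and let $H$ be the underlying graph of the line digraph $\delta G$. If $\chi(G)\leq\omega(\mathcal{S}(\mathbb{F},n))$, then $\xi_{\mathbb{F}}(H)\leq n$.
   Context: For $x,y\in\mathbb{F}^n$, $\langle x,y\rangle=\sum_i x_iy_i$ over $\mathbb{F}$; for a subspace $U$, $U^{\perp}=\{w:\langle w,u\rangle=0\ \forall u\in U\}$. $\mathcal{S}(\mathbb{F},n)$ is the graph whose vertices are all subspaces of $\mathbb{F}^n$, two distinct subspaces $U_1,U_2$ being adjacent iff there is $w\in U_1\cap U_2^{\perp}$ with $\langle w,w\rangle\neq 0$ and there is $w'\in U_2\cap U_1^{\perp}$ with $\langle w',w'\rangle\ne 0$. $\omega$ denotes the clique number and $\chi$ the chromatic number. A $k$-dimensional orthogonal representation of a graph $G=(V,E)$ over $\mathbb{F}$ assigns to each $v$ a vector $u_v\in\mathbb{F}^k$ with $\langle u_v,u_v\rangle\ne 0$ such that adjacent vertices get orthogonal vectors; $\xi_{\mathbb{F}}(G)$ is the least such $k$. The line digraph $\delta G$ has as vertices all ordered pairs $(x,y)$ with $\{x,y\}$ an edge of $G$, with a directed edge from $(x,y)$ to $(z,w)$ whenever $y=z$; $H$ is obtained by ignoring directions. -}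

module Defs where

open import Level using (Level; _⊔_; suc)
open import Algebra.Bundles using (CommutativeRing)
open import Data.Nat using (ℕ; zero; _<_)
import Data.Nat as ℕ
open import Data.Fin using (Fin)
import Data.Fin as F
open import Data.Product using (Σ; ∃; _×_; _,_; proj₁; proj₂)
open import Data.Sum using (_⊎_)
open import Data.Empty using (⊥)
open import Relation.Nullary using (¬_)
open import Relation.Binary.PropositionalEquality using (_≡_)

record Field (c ℓ : Level) : Set (suc (c ⊔ ℓ)) where
  field
    commutativeRing : CommutativeRing c ℓ
  open CommutativeRing commutativeRing public
  field
    1#≉0#   : ¬ (1# ≈ 0#)
    inverse : ∀ x → ¬ (x ≈ 0#) → Σ Carrier (λ y → (x * y) ≈ 1#)

module LinAlg {c ℓ : Level} (𝔽 : Field c ℓ) where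
  open Field 𝔽

  Vec : ℕ → Set c
  Vec n = Fin n → Carrier

  ⟨_,_⟩ : ∀ {n} → Vec n → Vec n → Carrier
  ⟨_,_⟩ {zero}    x y = 0#
  ⟨_,_⟩ {ℕ.suc n} x y = (x F.zero * y F.zero) + ⟨ (λ i → x (F.suc i)) , (λ i → y (F.suc i)) ⟩

  zeroV : ∀ {n} → Vec n
  zeroV _ = 0#

  _+V_ : ∀ {n} → Vec n → Vec n → Vec n
  (x +V y) i = x i + y i

  _·V_ : ∀ {n} → Carrier → Vec n → Vec n
  (a ·V x) i = a * x i

  _≈V_ : ∀ {n} → Vec n → Vec n → Set ℓ
  x ≈V y = ∀ i → x i ≈ y i

  record Subspace (n : ℕ) : Set (suc (c ⊔ ℓ)) where
    field
      _∈U      : Vec n → Set (c ⊔ ℓ)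
      resp     : ∀ {x y} → x ≈V y → x ∈U → y ∈U
      zero∈    : zeroV ∈U
      +-closed : ∀ {x y} → x ∈U → y ∈U → (x +V y) ∈U
      ·-closed : ∀ a {x} → x ∈U → (a ·V x) ∈U
  open Subspace public

  _≐_ : ∀ {n} → Subspace n → Subspace n → Set (c ⊔ ℓ)
  U ≐ V = ∀ x → (_∈U U x → _∈U V x) × (_∈U V x → _∈U U x)

  _∈⊥_ : ∀ {n} → Vec n → Subspace n → Set (c ⊔ ℓ)
  w ∈⊥ U = ∀ u → _∈U U u → ⟨ w , u ⟩ ≈ 0#

  SAdj : ∀ {n} → Subspace n → Subspace n → Set (c ⊔ ℓ)
  SAdj U₁ U₂ =
    ¬ (U₁ ≐ U₂)
    × Σ (Vec _) (λ w  → _∈U U₁ w  × (w  ∈⊥ U₂) × ¬ (⟨ w , w ⟩ ≈ 0#))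
    × Σ (Vec _) (λ w′ → _∈U U₂ w′ × (w′ ∈⊥ U₁) × ¬ (⟨ w′ , w′ ⟩ ≈ 0#))

  -- k ≤ ω(𝒮(𝔽,n)): 𝒮(𝔽,n) contains a clique on k (pairwise distinct) vertices
  CliqueOfSize : ℕ → ℕ → Set (suc (c ⊔ ℓ))
  CliqueOfSize n k =
    Σ (Fin k → Subspace n) λ U →
      ∀ i j → ¬ (i ≡ j) → SAdj (U i) (U j)

record Graph : Set₁ where
  field
    m     : ℕ
    E     : Fin m → Fin m → Set
    sym   : ∀ {x y} → E x y → E y x
    irrefl : ∀ {x} → ¬ E x x
open Graph public

Colouring : Graph → ℕ → Set
Colouring G k = Σ (Fin (m G) → Fin k) λ col → ∀ {x y} → E G x y → ¬ (col x ≡ col y)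

IsChromaticNumber : Graph → ℕ → Set
IsChromaticNumber G k = Colouring G k × (∀ j → j < k → ¬ Colouring G j)

-- The underlying undirected graph H of the line digraph δG.
-- Vertices: ordered pairs (x , y) with {x,y} an edge of G.
HVertex : Graph → Set
HVertex G = Σ (Fin (m G) × Fin (m G)) λ p → E G (proj₁ p) (proj₂ p)

δArc : (G : Graph) → HVertex G → HVertex G → Set
δArc G ((x , y) , _) ((z , w) , _) = y ≡ z

HAdj : (G : Graph) → HVertex G → HVertex G → Set
HAdj G a b = δArc G a b ⊎ δArc G b a

module OrthRep {c ℓ : Level} (𝔽 : Field c ℓ) where
  open Field 𝔽
  open LinAlg 𝔽

  OrthogonalRepresentation : (V : Set) → (V → V → Set) → ℕ → Set (c ⊔ ℓ)
  OrthogonalRepresentation V Adj k =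
    Σ (V → Vec k) λ u →
      (∀ v → ¬ (⟨ u v , u v ⟩ ≈ 0#))
      × (∀ v w → Adj v w → ⟨ u v , u w ⟩ ≈ 0#)

  ξ≤ : (V : Set) → (V → V → Set) → ℕ → Set (c ⊔ ℓ)
  ξ≤ V Adj n = Σ ℕ λ k → (k ℕ.≤ n) × OrthogonalRepresentation V Adj k

{-# OPTIONS --safe #-}
-- Colour G properly with χ colours and send colour i to the i-th member Uᵢ of a
-- clique of 𝒮(𝔽,n). For an arc (x , y), adjacency of U_{col x} and U_{col y}
-- supplies an anisotropic vector of U_{col x} orthogonal to U_{col y}; assign it
-- to (x , y). Along an arc (x , y) → (y , z) of δG the first vector is
-- orthogonal to U_{col y}, which contains the second.
module Submission where

open import Defs
open import Level using (Level; _⊔_)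
open import Data.Nat using (ℕ; _≤_; zero; suc)
open import Data.Nat.Properties using (≤-refl)
open import Data.Fin using (Fin)
import Data.Fin as Fin
open import Data.Product using (Σ; _×_; _,_; proj₁; proj₂)
open import Data.Sum using (inj₁; inj₂)
open import Relation.Nullary using (¬_)
open import Relation.Binary.PropositionalEquality using (refl)

module _ {c ℓ : Level} (𝔽 : Field c ℓ) where
  open Field 𝔽 using (_≈_; 0#; +-cong; *-comm; trans)
    renaming (refl to ≈-refl)
  open LinAlg 𝔽
  open OrthRep 𝔽

  ⟨⟩-comm : ∀ {k} (x y : Vec k) → ⟨ x , y ⟩ ≈ ⟨ y , x ⟩
  ⟨⟩-comm {zero}  x y = ≈-refl
  ⟨⟩-comm {suc k} x y =
    +-cong (*-comm _ _) (⟨⟩-comm (λ i → x (Fin.suc i)) (λ i → y (Fin.suc i)))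

  AnisotropicIn_⊥_ : ∀ {k} → Subspace k → Subspace k → Set (c ⊔ ℓ)
  AnisotropicIn U₁ ⊥ U₂ = Σ (Vec _) λ w → _∈U U₁ w × (w ∈⊥ U₂) × ¬ (⟨ w , w ⟩ ≈ 0#)

  SAdj⇒AnisotropicIn⊥ : ∀ {k} (U₁ U₂ : Subspace k) → SAdj U₁ U₂ → AnisotropicIn U₁ ⊥ U₂
  SAdj⇒AnisotropicIn⊥ _ _ (_ , w , _) = w

  lineDigraphRepresentation :
    ∀ {k} (G : Graph) (W : Fin (m G) → Subspace k) →
    (∀ {x y} → E G x y → AnisotropicIn W x ⊥ W y) →
    OrthogonalRepresentation (HVertex G) (HAdj G) k
  lineDigraphRepresentation G W sep = u , anisotropic , orthogonal
    where
    u : HVertex G → Vec _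
    u (_ , e) = proj₁ (sep e)

    u∈W-source : ∀ {x y} (e : E G x y) → _∈U (W x) (u (_ , e))
    u∈W-source e = proj₁ (proj₂ (sep e))

    u∈W-target⊥ : ∀ {x y} (e : E G x y) → u (_ , e) ∈⊥ W y
    u∈W-target⊥ e = proj₁ (proj₂ (proj₂ (sep e)))

    anisotropic : ∀ a → ¬ (⟨ u a , u a ⟩ ≈ 0#)
    anisotropic (_ , e) = proj₂ (proj₂ (proj₂ (sep e)))

    arc-orthogonal : ∀ a b → δArc G a b → ⟨ u a , u b ⟩ ≈ 0#
    arc-orthogonal ((_ , y) , e) ((.y , _) , e′) refl =
      u∈W-target⊥ e (u (_ , e′)) (u∈W-source e′)

    orthogonal : ∀ a b → HAdj G a b → ⟨ u a , u b ⟩ ≈ 0#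
    orthogonal a b (inj₁ a→b) = arc-orthogonal a b a→b
    orthogonal a b (inj₂ b→a) = trans (⟨⟩-comm (u a) (u b)) (arc-orthogonal b a b→a)

lemma3p8 : {c ℓ : Level} (𝔽 : Field c ℓ) (n : ℕ) → 1 ≤ n →
    (G : Graph) → (χ : ℕ) → IsChromaticNumber G χ →
    LinAlg.CliqueOfSize 𝔽 n χ →
    OrthRep.ξ≤ 𝔽 (HVertex G) (HAdj G) n
lemma3p8 𝔽 n _ G χ ((col , proper) , _) (U , clique) =
  n , ≤-refl ,
  lineDigraphRepresentation 𝔽 G (λ x → U (col x))
    (λ {x} {y} e →
      SAdj⇒AnisotropicIn⊥ 𝔽 (U (col x)) (U (col y)) (clique (col x) (col y) (proper e)))
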